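{- Let $\phi$ be the map defined in the context. For every $n\geq 0$, $\phi(\mathcal{E}_n)=\mathcal{A}'_n$.
   Context: Steps: $U=(1,1)$, $D=(1,-1)$, $D_i=(1,-i)$ for $i\geq 2$; set $D_1=D$. A Dyck meander with catastrophes of length $n$ is a sequence of $n$ steps from $\{U,D\}\cup\{D_i: i\geq 2\}$, starting at $(0,0)$, never going below the $x$-axis, such that every step $D_i$ ($i\ge 2$) ends on the $x$-axis. $\mathcal{M}_n$ is the set of these, $\mathcal{M}=\bigcup_n\mathcal{M}_n$; $\epsilon$ is the empty path. A Dyck excursion with catastrophes is a Dyck meander with catastrophes ending on the $x$-axis; $\mathcal{E}_n$ is the set of those of length $n$. An occurrence of a pattern (a factor of consecutive steps) is at height $h$ if the minimal ordinate of the points of the occurrence is $h$; an occurrence "on the $x$-axis" is one at height $0$. $\mathcal{A}_n$ is the set of Dyck paths of semilength $n$ having no occurrence of $UUU$ and no occurrence of $DUD$ at height $h>0$. $\mathcal{A}'_n$ is the set of paths $P\in\mathcal{A}_n$ such that every occurrence of $UD$ on the $x$-axis in $P$ is followed (later in $P$, not necessarily contiguously) by an occurrence of $UUU$. The map $\phi:\mathcal{M}\to\{\text{Dyck paths}\}$ is defined recursively. $\phi(\epsilon)=\epsilon$. A nonempty $P\in\mathcal{M}$ starts with $U$. If $P$ never returns to the $x$-axis after its first step, write $P=U\alpha$; then $\alpha$ consists of $U$, $D$ steps and, translated down by one unit, is in $\mathcal{M}$, and $\phi(P)=UD\phi(\alpha)$. Otherwise let $s$ be the first step of $P$ ending on the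 $x$-axis and write $P=U\alpha s\beta$ with $\beta\in\mathcal{M}$, where $\alpha$ consists of $U,D$ steps; translating paths so that they start at $(0,0)$: - if $s=D$: $\phi(P)=UUD\,\phi(\alpha)\,D\,\phi(\beta)$ (here $\alpha$ is a Dyck path); - if $s=D_2$: $\phi(P)=U\,\phi(\alpha D)\,D\,\phi(\beta)$ (here $\alpha D$ is a Dyck path); - if $s=D_i$ with $i\geq3$: $\phi(P)=UD\,\phi(\alpha D_{i-1})\,\phi(\beta)$ (here $\alpha D_{i-1}\in\mathcal{M}$ ends on the $x$-axis). -}

module Defs where

open import Data.Nat using (ℕ; zero; suc; _+_; _*_; _∸_; _⊓_; _<_; _≟_)
open import Data.List using (List; []; _∷_; _++_; [_]; length)
open import Data.Product using (Σ; _×_; _,_; ∃; ∃-syntax)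
open import Data.Sum using (_⊎_; inj₁; inj₂)
open import Relation.Nullary using (¬_; yes; no)
open import Relation.Binary.PropositionalEquality using (_≡_)

-- Steps of meanders with catastrophes.
-- U = (1,1), D = (1,-1), Dc k = D_{k+2} = (1,-(k+2)).
data Step : Set where
  U  : Step
  D  : Step
  Dc : ℕ → Step

data MW : ℕ → List Step → ℕ → Set where
  nil  : ∀ {h} → MW h [] h
  up   : ∀ {h xs e} → MW (suc h) xs e → MW h (U ∷ xs) e
  down : ∀ {h xs e} → MW h xs e → MW (suc h) (D ∷ xs) e
  cat  : ∀ {k xs e} → MW 0 xs e → MW (suc (suc k)) (Dc k ∷ xs) e

IsMeander : ℕ → List Step → Set
IsMeander n P = length P ≡ n × ∃[ e ] MW 0 P e

IsExcursion : ℕ → List Step → Set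
IsExcursion n P = length P ≡ n × MW 0 P 0

data DStep : Set where
  up dn : DStep

data DW : ℕ → List DStep → ℕ → Set where
  nil  : ∀ {h} → DW h [] h
  up   : ∀ {h xs e} → DW (suc h) xs e → DW h (up ∷ xs) e
  down : ∀ {h xs e} → DW h xs e → DW (suc h) (dn ∷ xs) e

IsDyck : ℕ → List DStep → Set
IsDyck n P = length P ≡ 2 * n × DW 0 P 0

endH : ℕ → List DStep → ℕ
endH h []        = h
endH h (up ∷ q)  = endH (suc h) q
endH h (dn ∷ q)  = endH (h ∸ 1) q

minFrom : ℕ → List DStep → ℕ
minFrom h []        = h
minFrom h (up ∷ q)  = h ⊓ minFrom (suc h) q
minFrom h (dn ∷ q)  = h ⊓ minFrom (h ∸ 1) q

Occurs : List DStep → List DStep → Set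
Occurs pat P = ∃[ pre ] ∃[ suf ] P ≡ pre ++ pat ++ suf

OccursAt : List DStep → List DStep → ℕ → Set
OccursAt pat P h =
  ∃[ pre ] ∃[ suf ] (P ≡ pre ++ pat ++ suf × minFrom (endH 0 pre) pat ≡ h)

UUU DUD UD : List DStep
UUU = up ∷ up ∷ up ∷ []
DUD = dn ∷ up ∷ dn ∷ []
UD  = up ∷ dn ∷ []

IsA : ℕ → List DStep → Set
IsA n P = IsDyck n P
        × (∀ h → 0 < h → ¬ OccursAt UUU P h)
        × (∀ h → 0 < h → ¬ OccursAt DUD P h)

IsA' : ℕ → List DStep → Set
IsA' n P = IsA n P
         × (∀ pre suf → P ≡ pre ++ UD ++ suf → minFrom (endH 0 pre) UD ≡ 0
              → Occurs UUU suf)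

-- Decomposition of the part after the first U step: scanning from
-- height h, either find the first step s ending on the x-axis
-- (inj₁ (α , s , β)), or the path never returns (inj₂ α).
Split : Set
Split = (List Step × Step × List Step) ⊎ List Step

consS : Step → Split → Split
consS x (inj₁ (a , s , b)) = inj₁ (x ∷ a , s , b)
consS x (inj₂ a)           = inj₂ (x ∷ a)

split : ℕ → List Step → Split
split h []             = inj₂ []
split h (U ∷ xs)       = consS U (split (suc h) xs)
split h (D ∷ xs) with h ≟ 1
... | yes _ = inj₁ ([] , D , xs)
... | no  _ = consS D (split (h ∸ 1) xs)
split h (Dc k ∷ xs) with h ≟ suc (suc k)
... | yes _ = inj₁ ([] , Dc k , xs)
... | no  _ = consS (Dc k) (split (h ∸ suc (suc k)) xs)

-- φ with a fuel argument (fuel = length of the path suffices, since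
-- all recursive calls are on strictly shorter paths).
φ′ : ℕ → List Step → List DStep
φ′ zero    _          = []
φ′ (suc f) []         = []
φ′ (suc f) (U ∷ xs) with split 1 xs
... | inj₂ α                    = up ∷ dn ∷ φ′ f α
... | inj₁ (α , D , β)          = up ∷ up ∷ dn ∷ (φ′ f α ++ dn ∷ φ′ f β)
... | inj₁ (α , Dc zero , β)    = up ∷ (φ′ f (α ++ [ D ]) ++ dn ∷ φ′ f β)
... | inj₁ (α , Dc (suc k) , β) = up ∷ dn ∷ (φ′ f (α ++ [ Dc k ]) ++ φ′ f β)
... | inj₁ (α , U , β)          = []   -- impossible: U never ends on the axis
φ′ (suc f) (D ∷ xs)    = []   -- not a meander
φ′ (suc f) (Dc k ∷ xs) = []   -- not a meander

φ : List Step → List DStep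
φ P = φ′ (length P) P

{-# OPTIONS --safe #-}
-- Both sides are described by grammars. Decomposing an excursion at its first return to the
-- axis gives exactly the three cases of φ (return by D, by D₂, by Dᵢ with i ≥ 3), and φ sends
-- them to UUD t D g, U (UUD t D u) D g and UD g, where t, u range over the image
-- T ::= ε | UUD T D T of Dyck paths. For i ≥ 3 the recursion on α D_{i−1} ends in a D₂, so g
-- then contains a UUU. Reading these grammars backwards inverts φ, and a Dyck path belongs to
-- the image grammar iff, at every position, UUU starts only at height 0, DUD only at height ≤ 1
-- and UD at height 0 is followed by a UUU, which are precisely the conditions defining A′ₙ.
module Submission where

open import Defs
open import Data.Nat using (ℕ; zero; suc; _+_; _*_; _∸_; _≤_; _<_; z≤n; s≤s; _≟_)
open import Data.Nat.Properties using (*-cancelˡ-≡; <⇒≢; +-suc; +-comm; +-identityʳ; ≟-diag; ≤-refl; ≤-trans; n≤1+n)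
open import Data.Nat.Tactic.RingSolver using (solve-∀)
open import Data.List using (List; []; _∷_; _++_; [_]; _∷ʳ_; length; foldr)
open import Data.List.Properties using (length-++; ++-assoc; ++-identityʳ; foldr-++; ∷ʳ-++; length-++-≤ˡ; length-++-≤ʳ)
open import Data.Product using (_×_; _,_; ∃-syntax; proj₂)
open import Data.Sum using (inj₁; inj₂)
open import Data.Unit using (⊤; tt)
open import Data.Empty using (⊥-elim)
open import Relation.Nullary using (¬_; yes; no)
open import Function using (_∘_)
open import Relation.Binary.PropositionalEquality using (_≡_; refl; sym; trans; cong; cong₂; subst; module ≡-Reasoning)
open ≡-Reasoning

private variable
  a b P r : List Step
  e h f k : ℕ
  t u g w : List DStep

-- First-return decompositions

-- Both are split at the first
-- return to the axis, which is how φ reads a path.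
data Prefix : ℕ → List Step → Set where
  ε    : Prefix 0 []
  arch : Prefix 0 a → Prefix e b → Prefix e (U ∷ a ++ D ∷ b)
  rise : Prefix e a → Prefix (suc e) (U ∷ a)

data Meander : ℕ → List Step → Set where
  ε      : Meander 0 []
  archD  : Prefix 0 a → Meander e b → Meander e (U ∷ a ++ D ∷ b)
  archDc : Prefix (suc k) a → Meander e b → Meander e (U ∷ a ++ Dc k ∷ b)
  rise   : Prefix e a → Meander (suc e) (U ∷ a)

arch-∷ʳ : ∀ (a : List Step) s b x → (U ∷ a ++ s ∷ b) ∷ʳ x ≡ U ∷ a ++ s ∷ (b ∷ʳ x)
arch-∷ʳ a s b x = cong (U ∷_) (++-assoc a (s ∷ b) [ x ])

prefix-∷ʳ-U : Prefix e a → Prefix (suc e) (a ∷ʳ U)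
prefix-∷ʳ-U ε = rise ε
prefix-∷ʳ-U (arch {a = a} {b = b} pa pb) = subst (Prefix _) (sym (arch-∷ʳ a D b U)) (arch pa (prefix-∷ʳ-U pb))
prefix-∷ʳ-U (rise pa) = rise (prefix-∷ʳ-U pa)

prefix-∷ʳ-D : Prefix (suc e) a → Prefix e (a ∷ʳ D)
prefix-∷ʳ-D (arch {a = a} {b = b} pa pb) = subst (Prefix _) (sym (arch-∷ʳ a D b D)) (arch pa (prefix-∷ʳ-D pb))
prefix-∷ʳ-D {zero} (rise pa) = arch pa ε
prefix-∷ʳ-D {suc e} (rise pa) = rise (prefix-∷ʳ-D pa)

meander-∷ʳ-U : Meander e P → Meander (suc e) (P ∷ʳ U)
meander-∷ʳ-U ε = rise ε
meander-∷ʳ-U (archD {a = a} {b = b} pa m) = subst (Meander _) (sym (arch-∷ʳ a D b U)) (archD pa (meander-∷ʳ-U m))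
meander-∷ʳ-U (archDc {k = k} {a = a} {b = b} pa m) =
  subst (Meander _) (sym (arch-∷ʳ a (Dc k) b U)) (archDc pa (meander-∷ʳ-U m))
meander-∷ʳ-U (rise pa) = rise (prefix-∷ʳ-U pa)

meander-∷ʳ-D : Meander (suc e) P → Meander e (P ∷ʳ D)
meander-∷ʳ-D (archD {a = a} {b = b} pa m) = subst (Meander _) (sym (arch-∷ʳ a D b D)) (archD pa (meander-∷ʳ-D m))
meander-∷ʳ-D (archDc {k = k} {a = a} {b = b} pa m) =
  subst (Meander _) (sym (arch-∷ʳ a (Dc k) b D)) (archDc pa (meander-∷ʳ-D m))
meander-∷ʳ-D {zero} (rise pa) = archD pa ε
meander-∷ʳ-D {suc e} (rise pa) = rise (prefix-∷ʳ-D pa)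

meander-∷ʳ-Dc : Meander (suc (suc k)) P → Meander 0 (P ∷ʳ Dc k)
meander-∷ʳ-Dc {k} (archD {a = a} {b = b} pa m) =
  subst (Meander _) (sym (arch-∷ʳ a D b (Dc k))) (archD pa (meander-∷ʳ-Dc m))
meander-∷ʳ-Dc {k} (archDc {k = k′} {a = a} {b = b} pa m) =
  subst (Meander _) (sym (arch-∷ʳ a (Dc k′) b (Dc k))) (archDc pa (meander-∷ʳ-Dc m))
meander-∷ʳ-Dc (rise pa) = archDc pa ε

meander-++ : Meander h P → MW h r e → Meander e (P ++ r)
meander-++ {P = P} m nil = subst (Meander _) (sym (++-identityʳ P)) m
meander-++ {P = P} m (up {xs = r} w) = subst (Meander _) (∷ʳ-++ P U r) (meander-++ (meander-∷ʳ-U m) w)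
meander-++ {P = P} m (down {xs = r} w) = subst (Meander _) (∷ʳ-++ P D r) (meander-++ (meander-∷ʳ-D m) w)
meander-++ {P = P} m (cat {k} {r} w) = subst (Meander _) (∷ʳ-++ P (Dc k) r) (meander-++ (meander-∷ʳ-Dc m) w)

MW⇒Meander : MW 0 P e → Meander e P
MW⇒Meander = meander-++ ε

prefix-++ : Prefix e a → MW (e + h) r f → MW h (a ++ r) f
prefix-++ ε w = w
prefix-++ {h = h} {r = r} (arch {a = a} {b = b} pa pb) w =
  subst (λ z → MW h (U ∷ z) _) (sym (++-assoc a (D ∷ b) r)) (up (prefix-++ pa (down (prefix-++ pb w))))
prefix-++ {e = suc e} {h = h} {r = r} {f = f} (rise pa) w =
  up (prefix-++ pa (subst (λ z → MW z r f) (sym (+-suc e h)) w))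

Meander⇒MW : Meander 0 P → MW 0 P 0
Meander⇒MW ε = nil
Meander⇒MW (archD pa m) = up (prefix-++ pa (down (Meander⇒MW m)))
Meander⇒MW (archDc {k = k} {b = b} pa m) =
  up (prefix-++ pa (subst (λ z → MW z (Dc k ∷ b) 0) (+-comm 1 (suc k)) (cat (Meander⇒MW m))))

-- Unfolding φ along the first-return decomposition

split-prefix : Prefix e a → ∀ h r → split (suc h) (a ++ r) ≡ foldr consS (split (suc (e + h)) r) a
split-prefix ε h r = refl
split-prefix {e = e} (arch {a = a} {b = b} pa pb) h r = begin
  split (suc h) (U ∷ (a ++ D ∷ b) ++ r)
    ≡⟨ cong (λ z → split (suc h) (U ∷ z)) (++-assoc a (D ∷ b) r) ⟩
  consS U (split (suc (suc h)) (a ++ D ∷ b ++ r))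
    ≡⟨ cong (consS U) (split-prefix pa (suc h) (D ∷ b ++ r)) ⟩
  consS U (foldr consS (consS D (split (suc h) (b ++ r))) a)
    ≡⟨ cong (λ z → consS U (foldr consS (consS D z) a)) (split-prefix pb h r) ⟩
  consS U (foldr consS (foldr consS (split (suc (e + h)) r) (D ∷ b)) a)
    ≡⟨ cong (consS U) (foldr-++ consS _ a (D ∷ b)) ⟨
  foldr consS (split (suc (e + h)) r) (U ∷ a ++ D ∷ b) ∎
split-prefix {e = suc e} (rise {a = a} pa) h r =
  cong (consS U) (trans (split-prefix pa (suc h) r) (cong (λ z → foldr consS (split (suc z) r) a) (+-suc e h)))

foldr-consS-inj₁ : ∀ a s b → foldr consS (inj₁ ([] , s , b)) a ≡ inj₁ (a , s , b)
foldr-consS-inj₁ [] s b = refl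
foldr-consS-inj₁ (x ∷ a) s b = cong (consS x) (foldr-consS-inj₁ a s b)

split-Dc : h ≡ suc (suc k) → ∀ b → split h (Dc k ∷ b) ≡ inj₁ ([] , Dc k , b)
split-Dc eq b rewrite ≟-diag eq = refl

split-archD : Prefix 0 a → ∀ b → split 1 (a ++ D ∷ b) ≡ inj₁ (a , D , b)
split-archD {a} pa b = trans (split-prefix pa 0 (D ∷ b)) (foldr-consS-inj₁ a D b)

split-archDc : Prefix (suc k) a → ∀ b → split 1 (a ++ Dc k ∷ b) ≡ inj₁ (a , Dc k , b)
split-archDc {k} {a} pa b = begin
  split 1 (a ++ Dc k ∷ b)                           ≡⟨ split-prefix pa 0 (Dc k ∷ b) ⟩
  foldr consS (split (suc (suc k + 0)) (Dc k ∷ b)) a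
    ≡⟨ cong (λ z → foldr consS z a) (split-Dc (cong (suc ∘ suc) (+-identityʳ k)) b) ⟩
  foldr consS (inj₁ ([] , Dc k , b)) a              ≡⟨ foldr-consS-inj₁ a (Dc k) b ⟩
  inj₁ (a , Dc k , b)                               ∎

recombine : Split → List Step
recombine (inj₁ (a , s , b)) = a ++ s ∷ b
recombine (inj₂ a)           = a

recombine-consS : ∀ x sp → recombine (consS x sp) ≡ x ∷ recombine sp
recombine-consS x (inj₁ _) = refl
recombine-consS x (inj₂ _) = refl

recombine-split : ∀ h xs → recombine (split h xs) ≡ xs
recombine-split h [] = refl
recombine-split h (U ∷ xs) = trans (recombine-consS U (split (suc h) xs)) (cong (U ∷_) (recombine-split (suc h) xs))
recombine-split h (D ∷ xs) with h ≟ 1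
... | yes _ = refl
... | no  _ = trans (recombine-consS D (split (h ∸ 1) xs)) (cong (D ∷_) (recombine-split (h ∸ 1) xs))
recombine-split h (Dc k ∷ xs) with h ≟ suc (suc k)
... | yes _ = refl
... | no  _ = trans (recombine-consS (Dc k) (split (h ∸ suc (suc k)) xs))
                    (cong (Dc k ∷_) (recombine-split (h ∸ suc (suc k)) xs))

length-∷ʳ-≤ : ∀ (a : List Step) x s b → length (a ∷ʳ x) ≤ length (a ++ s ∷ b)
length-∷ʳ-≤ [] x s b = s≤s z≤n
length-∷ʳ-≤ (_ ∷ a) x s b = s≤s (length-∷ʳ-≤ a x s b)

length-after-≤ : ∀ (a : List Step) s b → length b ≤ length (a ++ s ∷ b)
length-after-≤ a s b = ≤-trans (n≤1+n _) (length-++-≤ʳ (s ∷ b) {a})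

φ′-U-fuel : ∀ {f g} xs → (∀ ys → length ys ≤ length xs → φ′ f ys ≡ φ′ g ys)
          → φ′ (suc f) (U ∷ xs) ≡ φ′ (suc g) (U ∷ xs)
φ′-U-fuel xs smaller with split 1 xs | recombine-split 1 xs
... | inj₂ a | refl = cong (λ z → up ∷ dn ∷ z) (smaller a ≤-refl)
... | inj₁ (a , U , b) | _ = refl
... | inj₁ (a , D , b) | refl =
  cong₂ (λ u v → up ∷ up ∷ dn ∷ u ++ dn ∷ v) (smaller a (length-++-≤ˡ a)) (smaller b (length-after-≤ a D b))
... | inj₁ (a , Dc zero , b) | refl =
  cong₂ (λ u v → up ∷ u ++ dn ∷ v)
    (smaller (a ∷ʳ D) (length-∷ʳ-≤ a D (Dc 0) b)) (smaller b (length-after-≤ a (Dc 0) b))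
... | inj₁ (a , Dc (suc k) , b) | refl =
  cong₂ (λ u v → up ∷ dn ∷ u ++ v)
    (smaller (a ∷ʳ Dc k) (length-∷ʳ-≤ a (Dc k) (Dc (suc k)) b)) (smaller b (length-after-≤ a (Dc (suc k)) b))

φ′-fuel : ∀ {f g} xs → length xs ≤ f → length xs ≤ g → φ′ f xs ≡ φ′ g xs
φ′-fuel {zero}  {zero}  [] _ _ = refl
φ′-fuel {zero}  {suc g} [] _ _ = refl
φ′-fuel {suc f} {zero}  [] _ _ = refl
φ′-fuel {suc f} {suc g} [] _ _ = refl
φ′-fuel {suc f} {suc g} (U ∷ xs) (s≤s p) (s≤s q) =
  φ′-U-fuel xs (λ ys le → φ′-fuel ys (≤-trans le p) (≤-trans le q))
φ′-fuel {suc f} {suc g} (D ∷ xs) _ _ = refl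
φ′-fuel {suc f} {suc g} (Dc k ∷ xs) _ _ = refl

φ′≡φ : ∀ {f} xs → length xs ≤ f → φ′ f xs ≡ φ xs
φ′≡φ xs le = φ′-fuel xs le ≤-refl

φ-archD : Prefix 0 a → φ (U ∷ a ++ D ∷ b) ≡ up ∷ up ∷ dn ∷ φ a ++ dn ∷ φ b
φ-archD {a} {b} pa rewrite split-archD pa b =
  cong₂ (λ u v → up ∷ up ∷ dn ∷ u ++ dn ∷ v) (φ′≡φ a (length-++-≤ˡ a)) (φ′≡φ b (length-after-≤ a D b))

φ-archD₂ : Prefix 1 a → φ (U ∷ a ++ Dc 0 ∷ b) ≡ up ∷ φ (a ∷ʳ D) ++ dn ∷ φ b
φ-archD₂ {a} {b} pa rewrite split-archDc pa b =
  cong₂ (λ u v → up ∷ u ++ dn ∷ v)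
    (φ′≡φ (a ∷ʳ D) (length-∷ʳ-≤ a D (Dc 0) b)) (φ′≡φ b (length-after-≤ a (Dc 0) b))

φ-archDᵢ : Prefix (suc (suc k)) a → φ (U ∷ a ++ Dc (suc k) ∷ b) ≡ up ∷ dn ∷ φ (a ∷ʳ Dc k) ++ φ b
φ-archDᵢ {k} {a} {b} pa rewrite split-archDc pa b =
  cong₂ (λ u v → up ∷ dn ∷ u ++ v)
    (φ′≡φ (a ∷ʳ Dc k) (length-∷ʳ-≤ a (Dc k) (Dc (suc k)) b)) (φ′≡φ b (length-after-≤ a (Dc (suc k)) b))

φ-arch-∷ʳ : Prefix 0 a → ∀ b s → φ ((U ∷ a ++ D ∷ b) ∷ʳ s) ≡ up ∷ up ∷ dn ∷ φ a ++ dn ∷ φ (b ∷ʳ s)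
φ-arch-∷ʳ {a} pa b s = trans (cong φ (arch-∷ʳ a D b s)) (φ-archD pa)

-- The image of φ

-- φDyck and φExc are the images of Dyck paths and of excursions; viaX is the image of a first
-- arch that returns to the axis by the step X.
data φDyck : List DStep → Set where
  ε    : φDyck []
  arch : φDyck t → φDyck u → φDyck (up ∷ up ∷ dn ∷ t ++ dn ∷ u)

data φExc : List DStep → Set where
  ε     : φExc []
  viaD  : φDyck t → φExc g → φExc (up ∷ up ∷ dn ∷ t ++ dn ∷ g)
  viaD₂ : φDyck t → φDyck u → φExc g → φExc (up ∷ (up ∷ up ∷ dn ∷ t ++ dn ∷ u) ++ dn ∷ g)
  viaDᵢ : φExc g → Occurs UUU g → φExc (up ∷ dn ∷ g)

occurs-++ˡ : ∀ {p} t → Occurs p u → Occurs p (t ++ u)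
occurs-++ˡ t (pre , suf , refl) = t ++ pre , suf , sym (++-assoc t pre _)

occurs-++ʳ : ∀ {p} u → Occurs p t → Occurs p (t ++ u)
occurs-++ʳ {p = p} u (pre , suf , refl) =
  pre , suf ++ u , trans (++-assoc pre (p ++ suf) u) (cong (pre ++_) (++-assoc p suf u))

φExc-++ : φExc g → φExc w → φExc (g ++ w)
φExc-++ ε w = w
φExc-++ (viaD {t = t} {g = g} pt pg) pw =
  subst φExc (cong (λ z → up ∷ up ∷ dn ∷ z) (sym (++-assoc t (dn ∷ g) _))) (viaD pt (φExc-++ pg pw))
φExc-++ (viaD₂ {t = t} {u = u} {g = g} pt pu pg) pw =
  subst φExc (cong (up ∷_) (sym (++-assoc (up ∷ up ∷ dn ∷ t ++ dn ∷ u) (dn ∷ g) _)))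
    (viaD₂ pt pu (φExc-++ pg pw))
φExc-++ (viaDᵢ {g = g} pg o) pw = viaDᵢ (φExc-++ pg pw) (occurs-++ʳ _ o)

φ-dyck : Prefix 0 a → φDyck (φ a)
φ-dyck ε = ε
φ-dyck (arch pa pb) = subst φDyck (sym (φ-archD pa)) (arch (φ-dyck pa) (φ-dyck pb))

φ-∷ʳ-D : Prefix 1 a → ∃[ t ] ∃[ u ] (φDyck t × φDyck u × φ (a ∷ʳ D) ≡ up ∷ up ∷ dn ∷ t ++ dn ∷ u)
φ-∷ʳ-D (arch {a = a} {b = b} pa pb) =
  φ a , φ (b ∷ʳ D) , φ-dyck pa , φ-dyck (prefix-∷ʳ-D pb) , φ-arch-∷ʳ pa b D
φ-∷ʳ-D (rise {a = a} pa) = φ a , [] , φ-dyck pa , ε , φ-archD pa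

occurs-arch : ∀ {p} t → Occurs p u → Occurs p (up ∷ up ∷ dn ∷ t ++ dn ∷ u)
occurs-arch t o = occurs-++ˡ (up ∷ up ∷ dn ∷ t) (occurs-++ˡ (dn ∷ []) o)

UUU-in-tail : Prefix (suc (suc k)) a → Occurs UUU (φ (a ∷ʳ Dc k))
UUU-in-tail {k} (arch {a = a} {b = b} pa pb) =
  subst (Occurs UUU) (sym (φ-arch-∷ʳ pa b (Dc k))) (occurs-arch (φ a) (UUU-in-tail pb))
UUU-in-tail {zero} (rise pa) with φ-∷ʳ-D pa
... | t , u , _ , _ , eq = [] , _ , trans (φ-archD₂ pa) (cong (λ z → up ∷ z ++ dn ∷ []) eq)
UUU-in-tail {suc k} (rise pa) =
  subst (Occurs UUU) (sym (φ-archDᵢ pa)) (occurs-++ˡ (up ∷ dn ∷ []) (occurs-++ʳ [] (UUU-in-tail pa)))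

φ-tail : Prefix (suc (suc k)) a → φExc (φ (a ∷ʳ Dc k))
φ-tail {k} (arch {b = b} pa pb) = subst φExc (sym (φ-arch-∷ʳ pa b (Dc k))) (viaD (φ-dyck pa) (φ-tail pb))
φ-tail {zero} (rise pa) with φ-∷ʳ-D pa
... | t , u , pt , pu , eq =
  subst φExc (sym (trans (φ-archD₂ pa) (cong (λ z → up ∷ z ++ dn ∷ []) eq))) (viaD₂ pt pu ε)
φ-tail {suc k} (rise pa) =
  subst φExc (sym (trans (φ-archDᵢ pa) (cong (λ z → up ∷ dn ∷ z) (++-identityʳ _))))
    (viaDᵢ (φ-tail pa) (UUU-in-tail pa))

φ-exc : Meander 0 P → φExc (φ P)
φ-exc ε = ε
φ-exc (archD pa m) = subst φExc (sym (φ-archD pa)) (viaD (φ-dyck pa) (φ-exc m))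
φ-exc (archDc {k = zero} pa m) with φ-∷ʳ-D pa
... | t , u , pt , pu , eq =
  subst φExc (sym (trans (φ-archD₂ pa) (cong (λ z → up ∷ z ++ dn ∷ _) eq))) (viaD₂ pt pu (φ-exc m))
φ-exc (archDc {k = suc k} pa m) =
  subst φExc (sym (φ-archDᵢ pa)) (viaDᵢ (φExc-++ (φ-tail pa) (φ-exc m)) (occurs-++ʳ _ (UUU-in-tail pa)))

length-arch : ∀ t u a b → length t ≡ 2 * length a → length u ≡ 2 * length b
            → length (up ∷ up ∷ dn ∷ t ++ dn ∷ u) ≡ 2 * length (U ∷ a ++ D ∷ b)
length-arch t u a b lt lu
  rewrite length-++ t {dn ∷ u} | length-++ a {D ∷ b} | lt | lu = identity (length a) (length b)
  where identity : ∀ x y → 3 + (2 * x + suc (2 * y)) ≡ 2 * suc (x + suc y)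
        identity = solve-∀

length-archD₂ : ∀ t u a b → length t ≡ 2 * length (a ∷ʳ D) → length u ≡ 2 * length b
              → length (up ∷ t ++ dn ∷ u) ≡ 2 * length (U ∷ a ++ Dc 0 ∷ b)
length-archD₂ t u a b lt lu
  rewrite length-++ t {dn ∷ u} | length-++ a {Dc 0 ∷ b} | lt | length-++ a {[ D ]} | lu = identity (length a) (length b)
  where identity : ∀ x y → suc (2 * (x + 1) + suc (2 * y)) ≡ 2 * suc (x + suc y)
        identity = solve-∀

length-archDᵢ : ∀ t u a b → length t ≡ 2 * length (a ∷ʳ Dc k) → length u ≡ 2 * length b
              → length (up ∷ dn ∷ t ++ u) ≡ 2 * length (U ∷ a ++ Dc (suc k) ∷ b)
length-archDᵢ {k} t u a b lt lu
  rewrite length-++ t {u} | length-++ a {Dc (suc k) ∷ b} | lt | length-++ a {[ Dc k ]} | lu = identity (length a) (length b)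
  where identity : ∀ x y → 2 + (2 * (x + 1) + 2 * y) ≡ 2 * suc (x + suc y)
        identity = solve-∀

length-φ-dyck : Prefix 0 a → length (φ a) ≡ 2 * length a
length-φ-dyck ε = refl
length-φ-dyck (arch {a = a} {b = b} pa pb) =
  trans (cong length (φ-archD pa)) (length-arch (φ a) (φ b) a b (length-φ-dyck pa) (length-φ-dyck pb))

length-φ-tail : Prefix (suc (suc k)) a → length (φ (a ∷ʳ Dc k)) ≡ 2 * length (a ∷ʳ Dc k)
length-φ-tail {k} (arch {a = a} {b = b} pa pb) = begin
  length (φ ((U ∷ a ++ D ∷ b) ∷ʳ Dc k))            ≡⟨ cong length (φ-arch-∷ʳ pa b (Dc k)) ⟩
  length (up ∷ up ∷ dn ∷ φ a ++ dn ∷ φ (b ∷ʳ Dc k))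
    ≡⟨ length-arch (φ a) _ a _ (length-φ-dyck pa) (length-φ-tail pb) ⟩
  2 * length (U ∷ a ++ D ∷ (b ∷ʳ Dc k))             ≡⟨ cong (λ z → 2 * length z) (arch-∷ʳ a D b (Dc k)) ⟨
  2 * length ((U ∷ a ++ D ∷ b) ∷ʳ Dc k)             ∎
length-φ-tail {zero} (rise {a = a} pa) =
  trans (cong length (φ-archD₂ pa)) (length-archD₂ (φ (a ∷ʳ D)) [] a [] (length-φ-dyck (prefix-∷ʳ-D pa)) refl)
length-φ-tail {suc k} (rise {a = a} pa) =
  trans (cong length (φ-archDᵢ pa)) (length-archDᵢ (φ (a ∷ʳ Dc k)) [] a [] (length-φ-tail pa) refl)

length-φ : Meander 0 P → length (φ P) ≡ 2 * length P
length-φ ε = refl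
length-φ (archD {a = a} {b = b} pa m) =
  trans (cong length (φ-archD pa)) (length-arch (φ a) (φ b) a b (length-φ-dyck pa) (length-φ m))
length-φ (archDc {k = zero} {a = a} {b = b} pa m) =
  trans (cong length (φ-archD₂ pa))
        (length-archD₂ (φ (a ∷ʳ D)) (φ b) a b (length-φ-dyck (prefix-∷ʳ-D pa)) (length-φ m))
length-φ (archDc {k = suc k} {a = a} {b = b} pa m) =
  trans (cong length (φ-archDᵢ pa)) (length-archDᵢ (φ (a ∷ʳ Dc k)) (φ b) a b (length-φ-tail pa) (length-φ m))

UUU-∉-dn∷ : Occurs UUU (dn ∷ w) → Occurs UUU w
UUU-∉-dn∷ ([] , _ , ())
UUU-∉-dn∷ (_ ∷ pre , suf , refl) = pre , suf , refl

UUU-∉-UUD∷ : Occurs UUU (up ∷ up ∷ dn ∷ w) → Occurs UUU w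
UUU-∉-UUD∷ ([] , _ , ())
UUU-∉-UUD∷ (_ ∷ [] , _ , ())
UUU-∉-UUD∷ (_ ∷ _ ∷ [] , _ , ())
UUU-∉-UUD∷ (_ ∷ _ ∷ _ ∷ pre , suf , refl) = pre , suf , refl

UUU-∉-φDyck : φDyck t → ∀ g → Occurs UUU (t ++ dn ∷ g) → Occurs UUU g
UUU-∉-φDyck ε g o = UUU-∉-dn∷ o
UUU-∉-φDyck (arch {t = t} {u = u} pt pu) g o =
  UUU-∉-φDyck pu g
    (UUU-∉-φDyck pt (u ++ dn ∷ g) (subst (Occurs UUU) (++-assoc t (dn ∷ u) (dn ∷ g)) (UUU-∉-UUD∷ o)))

-- Inverting φ on its image

dyck-preimage : φDyck t → ∃[ a ] (Prefix 0 a × φ a ≡ t)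
dyck-preimage ε = [] , ε , refl
dyck-preimage (arch pt pu) with dyck-preimage pt | dyck-preimage pu
... | a , pa , refl | b , pb , refl = U ∷ a ++ D ∷ b , arch pa pb , φ-archD pa

opening-arch : Prefix 0 a → Prefix 0 b → ∃[ a′ ] (Prefix 1 a′ × a′ ∷ʳ D ≡ U ∷ a ++ D ∷ b)
opening-arch {a} pa ε = U ∷ a , rise pa , refl
opening-arch {a} pa (arch pc pd) with opening-arch pc pd
... | a′ , pa′ , eq =
  U ∷ a ++ D ∷ a′ , arch pa pa′ , trans (arch-∷ʳ a D a′ D) (cong (λ z → U ∷ a ++ D ∷ z) eq)

φ-opening-arch : Prefix 0 a → Prefix 0 b
               → ∃[ a′ ] (Prefix 1 a′ × φ (a′ ∷ʳ D) ≡ up ∷ up ∷ dn ∷ φ a ++ dn ∷ φ b)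
φ-opening-arch pa pb with opening-arch pa pb
... | a′ , pa′ , eq = a′ , pa′ , trans (cong φ eq) (φ-archD pa)

mutual
  exc-preimage : φExc g → ∃[ P ] (Meander 0 P × φ P ≡ g)
  exc-preimage ε = [] , ε , refl
  exc-preimage (viaD pt pg) with dyck-preimage pt | exc-preimage pg
  ... | a , pa , refl | b , mb , refl = U ∷ a ++ D ∷ b , archD pa mb , φ-archD pa
  exc-preimage (viaD₂ pt pu pg) with dyck-preimage pt | dyck-preimage pu | exc-preimage pg
  ... | a₁ , p₁ , refl | b₁ , q₁ , refl | b , mb , refl with φ-opening-arch p₁ q₁
  ... | a , pa , eq =
    U ∷ a ++ Dc 0 ∷ b , archDc pa mb , trans (φ-archD₂ pa) (cong (λ z → up ∷ z ++ dn ∷ φ b) eq)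
  exc-preimage (viaDᵢ pg o) with tail-preimage pg o
  ... | k , a , b , pa , mb , refl = U ∷ a ++ Dc (suc k) ∷ b , archDc pa mb , φ-archDᵢ pa

  tail-preimage : φExc g → Occurs UUU g
                → ∃[ k ] ∃[ a ] ∃[ P ] (Prefix (suc (suc k)) a × Meander 0 P × φ (a ∷ʳ Dc k) ++ φ P ≡ g)
  tail-preimage ε ([] , _ , ())
  tail-preimage ε (_ ∷ _ , _ , ())
  tail-preimage (viaD {g = g} pt pg) o with dyck-preimage pt | tail-preimage pg (UUU-∉-φDyck pt g (UUU-∉-UUD∷ o))
  ... | a₁ , p₁ , refl | k , a , b , pa , mb , refl = k , U ∷ a₁ ++ D ∷ a , b , arch p₁ pa , mb , (begin
    φ ((U ∷ a₁ ++ D ∷ a) ∷ʳ Dc k) ++ φ b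
      ≡⟨ cong (_++ φ b) (φ-arch-∷ʳ p₁ a (Dc k)) ⟩
    (up ∷ up ∷ dn ∷ φ a₁ ++ dn ∷ φ (a ∷ʳ Dc k)) ++ φ b
      ≡⟨ cong (λ z → up ∷ up ∷ dn ∷ z) (++-assoc (φ a₁) _ (φ b)) ⟩
    up ∷ up ∷ dn ∷ φ a₁ ++ dn ∷ (φ (a ∷ʳ Dc k) ++ φ b) ∎)
  tail-preimage (viaD₂ pt pu pg) _ with dyck-preimage pt | dyck-preimage pu | exc-preimage pg
  ... | a₁ , p₁ , refl | b₁ , q₁ , refl | b , mb , refl with φ-opening-arch p₁ q₁
  ... | a , pa , eq = 0 , U ∷ a , b , rise pa , mb , (begin
    φ ((U ∷ a) ∷ʳ Dc 0) ++ φ b          ≡⟨ cong (_++ φ b) (φ-archD₂ pa) ⟩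
    (up ∷ φ (a ∷ʳ D) ++ dn ∷ []) ++ φ b ≡⟨ cong (up ∷_) (++-assoc (φ (a ∷ʳ D)) (dn ∷ []) (φ b)) ⟩
    up ∷ φ (a ∷ʳ D) ++ dn ∷ φ b         ≡⟨ cong (λ z → up ∷ z ++ dn ∷ φ b) eq ⟩
    up ∷ (up ∷ up ∷ dn ∷ φ a₁ ++ dn ∷ φ b₁) ++ dn ∷ φ b ∎)
  tail-preimage (viaDᵢ pg o) _ with tail-preimage pg o
  ... | k , a , b , pa , mb , refl = suc k , U ∷ a , b , rise pa , mb , (begin
    φ ((U ∷ a) ∷ʳ Dc (suc k)) ++ φ b       ≡⟨ cong (_++ φ b) (φ-archDᵢ pa) ⟩
    (up ∷ dn ∷ φ (a ∷ʳ Dc k) ++ []) ++ φ b ≡⟨ cong (λ z → up ∷ dn ∷ z ++ φ b) (++-identityʳ _) ⟩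
    up ∷ dn ∷ φ (a ∷ʳ Dc k) ++ φ b         ∎)

-- A′ₙ as local admissibility

data Dyck : List DStep → Set where
  ε    : Dyck []
  arch : Dyck t → Dyck u → Dyck (up ∷ t ++ dn ∷ u)

φDyck⇒Dyck : φDyck t → Dyck t
φDyck⇒Dyck ε = ε
φDyck⇒Dyck (arch pt pu) = arch (arch ε (φDyck⇒Dyck pt)) (φDyck⇒Dyck pu)

φExc⇒Dyck : φExc g → Dyck g
φExc⇒Dyck ε = ε
φExc⇒Dyck (viaD pt pg) = arch (arch ε (φDyck⇒Dyck pt)) (φExc⇒Dyck pg)
φExc⇒Dyck (viaD₂ pt pu pg) = arch (φDyck⇒Dyck (arch pt pu)) (φExc⇒Dyck pg)
φExc⇒Dyck (viaDᵢ pg _) = arch ε (φExc⇒Dyck pg)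

DW-++ : DW h t e → DW e u f → DW h (t ++ u) f
DW-++ nil q = q
DW-++ (up p) q = up (DW-++ p q)
DW-++ (down p) q = down (DW-++ p q)

Dyck⇒DW : Dyck t → DW h t h
Dyck⇒DW ε = nil
Dyck⇒DW (arch y z) = up (DW-++ (Dyck⇒DW y) (down (Dyck⇒DW z)))

data DyckSuffix : ℕ → List DStep → Set where
  dyck : Dyck t → DyckSuffix 0 t
  _dn∷_ : Dyck t → DyckSuffix h u → DyckSuffix (suc h) (t ++ dn ∷ u)

up∷-DyckSuffix : DyckSuffix (suc h) t → DyckSuffix h (up ∷ t)
up∷-DyckSuffix (y dn∷ dyck z) = dyck (arch y z)
up∷-DyckSuffix (_dn∷_ {t = t} y (_dn∷_ {t = t′} {u = u} z s)) =
  subst (DyckSuffix _) (cong (up ∷_) (++-assoc t (dn ∷ t′) (dn ∷ u))) (arch y z dn∷ s)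

DW⇒DyckSuffix : DW h t 0 → DyckSuffix h t
DW⇒DyckSuffix nil = dyck ε
DW⇒DyckSuffix (up p) = up∷-DyckSuffix (DW⇒DyckSuffix p)
DW⇒DyckSuffix (down p) = ε dn∷ DW⇒DyckSuffix p

DW⇒Dyck : DW 0 t 0 → Dyck t
DW⇒Dyck p with DW⇒DyckSuffix p
... | dyck y = y

-- The conditions defining A′ₙ, read at one position of height h followed by the steps w
-- (a DUD starting at height h occurs at height h ∸ 1).
Admissible : ℕ → List DStep → Set
Admissible h (up ∷ up ∷ up ∷ _) = h ≡ 0
Admissible h (up ∷ dn ∷ w)      = h ≡ 0 → Occurs UUU w
Admissible h (dn ∷ up ∷ dn ∷ _) = h ≤ 1
Admissible h _                  = ⊤

AdmissibleFrom : ℕ → List DStep → Set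
AdmissibleFrom h []       = ⊤
AdmissibleFrom h (up ∷ w) = Admissible h (up ∷ w) × AdmissibleFrom (suc h) w
AdmissibleFrom h (dn ∷ w) = Admissible h (dn ∷ w) × AdmissibleFrom (h ∸ 1) w

admissible-dn-low : h ≤ 1 → ∀ w → Admissible h (dn ∷ w)
admissible-dn-low h≤1 []                 = tt
admissible-dn-low h≤1 (dn ∷ _)           = tt
admissible-dn-low h≤1 (up ∷ [])          = tt
admissible-dn-low h≤1 (up ∷ up ∷ _)      = tt
admissible-dn-low h≤1 (up ∷ dn ∷ _)      = h≤1

admissible-dn-φDyck : φDyck t → ∀ h w → Admissible h (dn ∷ t ++ dn ∷ w)
admissible-dn-φDyck ε          h w = tt
admissible-dn-φDyck (arch _ _) h w = tt

admissible-φDyck : φDyck t → AdmissibleFrom h (dn ∷ w) → AdmissibleFrom h (t ++ dn ∷ w)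
admissible-φDyck ε s = s
admissible-φDyck {h = h} {w = w} (arch {t = t} {u = u} pt pu) s =
  tt , (λ ()) , subst (λ z → AdmissibleFrom (suc (suc h)) (dn ∷ z)) (sym (++-assoc t (dn ∷ u) (dn ∷ w)))
    (admissible-dn-φDyck pt _ _ , admissible-φDyck pt (admissible-dn-φDyck pu _ _ , admissible-φDyck pu s))

admissible-φExc : φExc g → AdmissibleFrom 0 g
admissible-φExc ε = tt
admissible-φExc (viaD {g = g} pt pg) =
  tt , (λ ()) , admissible-dn-φDyck pt 2 g , admissible-φDyck pt (admissible-dn-low (s≤s z≤n) g , admissible-φExc pg)
admissible-φExc (viaD₂ {t = t} {u = u} {g = g} pt pu pg) =
  refl , tt , (λ ()) , subst (λ z → AdmissibleFrom 3 (dn ∷ z)) (sym (++-assoc t (dn ∷ u) (dn ∷ g)))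
    (admissible-dn-φDyck pt 3 _ , admissible-φDyck pt (admissible-dn-φDyck pu 2 g ,
       admissible-φDyck pu (admissible-dn-low (s≤s z≤n) g , admissible-φExc pg)))
admissible-φExc (viaDᵢ {g = g} pg o) = (λ _ → o) , admissible-dn-low (s≤s z≤n) g , admissible-φExc pg

admissible-after : Dyck t → AdmissibleFrom h (t ++ w) → AdmissibleFrom h w
admissible-after ε s = s
admissible-after {h = h} {w = w} (arch {t = t} {u = u} y z) (_ , s) =
  admissible-after z (proj₂ (admissible-after y (subst (AdmissibleFrom (suc h)) (++-assoc t (dn ∷ u) w) s)))

mutual
  admissible⇒φDyck : Dyck t → Admissible (suc (suc h)) (dn ∷ t ++ w) → AdmissibleFrom (suc h) (t ++ w) → φDyck t
  admissible⇒φDyck ε _ _ = ε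
  admissible⇒φDyck (arch ε _) (s≤s ()) _
  admissible⇒φDyck (arch (arch (arch _ _) _) _) _ (() , _)
  admissible⇒φDyck (arch (arch ε y) z) _ (_ , _ , a , s) with inner-arch y a s
  ... | pt , a′ , s′ = arch pt (admissible⇒φDyck z a′ s′)

  inner-arch : Dyck t → Admissible (suc (suc h)) (dn ∷ (t ++ dn ∷ u) ++ w)
             → AdmissibleFrom (suc h) ((t ++ dn ∷ u) ++ w)
             → φDyck t × Admissible (suc h) (dn ∷ u ++ w) × AdmissibleFrom h (u ++ w)
  inner-arch {t = t} {h = h} {u = u} {w = w} y a s = admissible⇒φDyck y a′ s′ , admissible-after y s′
    where
    a′ : Admissible (suc (suc h)) (dn ∷ t ++ dn ∷ u ++ w)
    a′ = subst (λ v → Admissible (suc (suc h)) (dn ∷ v)) (++-assoc t (dn ∷ u) w) a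
    s′ : AdmissibleFrom (suc h) (t ++ dn ∷ u ++ w)
    s′ = subst (AdmissibleFrom (suc h)) (++-assoc t (dn ∷ u) w) s

admissible⇒φExc : Dyck g → AdmissibleFrom 0 g → φExc g
admissible⇒φExc ε _ = ε
admissible⇒φExc (arch ε z) (o , _ , s) = viaDᵢ (admissible⇒φExc z s) (o refl)
admissible⇒φExc (arch (arch ε y) z) (_ , _ , a , s) =
  viaD (admissible⇒φDyck y a s) (admissible⇒φExc z (proj₂ (admissible-after y s)))
admissible⇒φExc (arch (arch (arch ε y) x) z) (_ , _ , _ , a , s) with inner-arch y a s
... | pt , a′ , s′ =
  viaD₂ pt (admissible⇒φDyck x a′ s′) (admissible⇒φExc z (proj₂ (admissible-after x s′)))
admissible⇒φExc (arch (arch (arch (arch _ _) _) _) _) (_ , () , _)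

admissible-at : AdmissibleFrom h g → g ≡ t ++ w → Admissible (endH h t) w
admissible-at {g = []} {t = []} {w = []} _ refl = tt
admissible-at {g = up ∷ _} {t = []} (a , _) refl = a
admissible-at {g = dn ∷ _} {t = []} (a , _) refl = a
admissible-at {g = up ∷ _} {t = up ∷ t} (_ , s) refl = admissible-at {t = t} s refl
admissible-at {g = dn ∷ _} {t = dn ∷ t} (_ , s) refl = admissible-at {t = t} s refl

admissibleFrom-intro : (∀ t w → g ≡ t ++ w → Admissible (endH h t) w) → AdmissibleFrom h g
admissibleFrom-intro {g = []} H = tt
admissibleFrom-intro {g = up ∷ g} H = H [] _ refl , admissibleFrom-intro (λ t w eq → H (up ∷ t) w (cong (up ∷_) eq))
admissibleFrom-intro {g = dn ∷ g} H = H [] _ refl , admissibleFrom-intro (λ t w eq → H (dn ∷ t) w (cong (dn ∷_) eq))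

admissible-intro : (∀ r → w ≡ UUU ++ r → h ≡ 0) → (∀ r → w ≡ UD ++ r → h ≡ 0 → Occurs UUU r)
                 → (∀ r → w ≡ DUD ++ r → h ≤ 1) → Admissible h w
admissible-intro {w = []}                   _ _ _ = tt
admissible-intro {w = up ∷ []}              _ _ _ = tt
admissible-intro {w = up ∷ up ∷ []}         _ _ _ = tt
admissible-intro {w = up ∷ up ∷ dn ∷ _}     _ _ _ = tt
admissible-intro {w = up ∷ up ∷ up ∷ r}     uuu _ _ = uuu r refl
admissible-intro {w = up ∷ dn ∷ r}          _ ud _ = ud r refl
admissible-intro {w = dn ∷ []}              _ _ _ = tt
admissible-intro {w = dn ∷ dn ∷ _}          _ _ _ = tt
admissible-intro {w = dn ∷ up ∷ []}         _ _ _ = tt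
admissible-intro {w = dn ∷ up ∷ up ∷ _}     _ _ _ = tt
admissible-intro {w = dn ∷ up ∷ dn ∷ r}     _ _ dud = dud r refl

minFrom-UUU : ∀ h → minFrom h UUU ≡ h
minFrom-UUU zero = refl
minFrom-UUU (suc h) = cong suc (minFrom-UUU h)

minFrom-UD : ∀ h → minFrom h UD ≡ h
minFrom-UD zero = refl
minFrom-UD (suc h) = cong suc (minFrom-UD h)

minFrom-DUD : h ≤ 1 → minFrom h DUD ≡ 0
minFrom-DUD z≤n = refl
minFrom-DUD (s≤s z≤n) = refl

admissible⇒no-high-UUU : AdmissibleFrom 0 g → ∀ h → 0 < h → ¬ OccursAt UUU g h
admissible⇒no-high-UUU s h 0<h (t , w , eq , m) = <⇒≢ 0<h (begin
  0                      ≡⟨ admissible-at s eq ⟨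
  endH 0 t               ≡⟨ minFrom-UUU (endH 0 t) ⟨
  minFrom (endH 0 t) UUU ≡⟨ m ⟩
  h                      ∎)

admissible⇒no-high-DUD : AdmissibleFrom 0 g → ∀ h → 0 < h → ¬ OccursAt DUD g h
admissible⇒no-high-DUD s h 0<h (t , w , eq , m) = <⇒≢ 0<h (trans (sym (minFrom-DUD (admissible-at s eq))) m)

admissible⇒UD-then-UUU : AdmissibleFrom 0 g
                       → ∀ t w → g ≡ t ++ UD ++ w → minFrom (endH 0 t) UD ≡ 0 → Occurs UUU w
admissible⇒UD-then-UUU s t w eq m = admissible-at s eq (trans (sym (minFrom-UD (endH 0 t))) m)

no-high-UUU⇒ground : (∀ h → 0 < h → ¬ OccursAt UUU g h) → g ≡ t ++ UUU ++ w → endH 0 t ≡ 0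
no-high-UUU⇒ground {t = t} {w = w} c eq with endH 0 t in e
... | zero  = refl
... | suc h = ⊥-elim (c (suc h) (s≤s z≤n) (t , w , eq , trans (cong (λ z → minFrom z UUU) e) (minFrom-UUU (suc h))))

no-high-DUD⇒low : (∀ h → 0 < h → ¬ OccursAt DUD g h) → g ≡ t ++ DUD ++ w → endH 0 t ≤ 1
no-high-DUD⇒low {t = t} {w = w} c eq with endH 0 t in e
... | zero        = z≤n
... | suc zero    = s≤s z≤n
... | suc (suc h) = ⊥-elim (c _ (s≤s z≤n) (t , w , eq , cong (λ z → minFrom z DUD) e))
  -- a DUD starting at height 2 + h stays at height ≥ 1 + h

conditions⇒admissible : (∀ h → 0 < h → ¬ OccursAt UUU g h) → (∀ h → 0 < h → ¬ OccursAt DUD g h)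
                      → (∀ t w → g ≡ t ++ UD ++ w → minFrom (endH 0 t) UD ≡ 0 → Occurs UUU w)
                      → AdmissibleFrom 0 g
conditions⇒admissible c₁ c₂ c₃ = admissibleFrom-intro λ t w eq → admissible-intro
  (λ r eq′ → no-high-UUU⇒ground c₁ (trans eq (cong (t ++_) eq′)))
  (λ r eq′ e → c₃ t r (trans eq (cong (t ++_) eq′)) (trans (minFrom-UD (endH 0 t)) e))
  (λ r eq′ → no-high-DUD⇒low c₂ (trans eq (cong (t ++_) eq′)))

φExc⇒A′ : ∀ n → φExc g → length g ≡ 2 * n → IsA' n g
φExc⇒A′ {g = g} n pg len =
  ((len , Dyck⇒DW (φExc⇒Dyck pg)) , admissible⇒no-high-UUU adm , admissible⇒no-high-DUD adm)
  , admissible⇒UD-then-UUU adm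
  where
  adm : AdmissibleFrom 0 g
  adm = admissible-φExc pg

A′⇒φExc : ∀ n → IsA' n g → φExc g
A′⇒φExc n (((_ , dw) , c₁ , c₂) , c₃) = admissible⇒φExc (DW⇒Dyck dw) (conditions⇒admissible c₁ c₂ c₃)

theorem2 : (n : ℕ)
    → ((P : List Step) → IsExcursion n P → IsA' n (φ P))
      × ((Q : List DStep) → IsA' n Q → ∃[ P ] (IsExcursion n P × φ P ≡ Q))
theorem2 n = into , onto
  where
  into : (P : List Step) → IsExcursion n P → IsA' n (φ P)
  into P (len , w) = φExc⇒A′ n (φ-exc m) (trans (length-φ m) (cong (2 *_) len))
    where
    m : Meander 0 P
    m = MW⇒Meander w

  onto : (Q : List DStep) → IsA' n Q → ∃[ P ] (IsExcursion n P × φ P ≡ Q)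
  onto Q a′@(((len , _) , _) , _) with exc-preimage (A′⇒φExc n a′)
  ... | P , m , refl = P , (*-cancelˡ-≡ (length P) n 2 (trans (sym (length-φ m)) len) , Meander⇒MW m) , refl
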